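{- Let $\mathbb{K}$ be a commutative ring and $N\ge1$. Let $F$ be an $N$-tuple of formal power series in $N$ non-commuting indeterminates with coefficients in $\mathbb{K}$ whose $i$-th component is \[ F_i(X_1,\ldots,X_N)=\sum_{j=1}^N P_{i,j}X_j-\sum_{k\ge2}\sum_{\kappa\in[N]^k}H_{i,\kappa}X_\kappa, \] where $P=(P_{i,j})$ is an $N\times N$ matrix over $\mathbb{K}$. If $P$ is invertible with inverse $Q=(Q_{i,j})$, then $F$ has a compositional inverse $G$ ($F\circ G=G\circ F=I$, $I_i=X_i$), whose $i$-th component is \[ G_i=\sum_{j=1}^NQ_{i,j}X_j+\sum_{k\ge2}\sum_{\kappa\in[N]^k}G_{i,\kappa}X_\kappa,\qquad G_{i,\kappa}=\sum_{\overrightarrow{\mathcal{T}}\in\overrightarrow{\mathbb{A}}_{i,\kappa}}\ \prod_{v\text{ internal, even}}Q_{\tau(v),\,j(v)}\prod_{v\text{ internal, odd}}H_{\tau(v),\overrightarrow{\mu}(v)}, \] where "even/odd" refers to the parity of the distance of $v$ from the root and $j(v)$ is the type of the unique child of an even internal vertex $v$.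
   Context: $[N]=\{1,\ldots,N\}$; for $\kappa\in[N]^k$, $X_\kappa=X_{\kappa_1}\cdots X_{\kappa_k}$; variables do not commute with each other but commute with coefficients; composition is substitution $(F\circ G)_i=F_i(G_1,\ldots,G_N)$. A rooted planar tree is a finite rooted tree (root $v_0$, generation $V_r$ = vertices at distance $r$ from root) in which the children of each vertex are linearly ordered, inducing a left-to-right order on the leaves. $\overrightarrow{\mathbb{A}}_{i,\kappa}$ is the set of isomorphism classes (under order- and type-preserving rooted isomorphisms) of rooted planar trees with $k$ leaves in which every vertex in an even generation has exactly one child and every vertex in an odd generation has either no children or at least two children, together with a type function $\tau:V\to[N]$ with $\tau(v_0)=i$ and the $j$-th leaf from the left having type $\kappa_j$. For an internal vertex $v$ with ordered children $w_1,\ldots,w_r$, $\overrightarrow{\mu}(v)=(\tau(w_1),\ldots,\tau(w_r))$. -}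

module Defs where

open import Level using (Level)
open import Algebra.Bundles using (CommutativeRing)
open import Data.Nat using (ℕ; zero; suc)
open import Data.Fin using (Fin)
open import Data.List using (List; []; _∷_; _++_; map; concatMap; length; allFin; upTo)
open import Data.Product using (_×_; _,_)
import Data.Fin
import Relation.Nullary

-- Noncommutative formal power series in N indeterminates X_1..X_N (indexed by Fin N)
-- with coefficients in a commutative ring R: a series is its coefficient function on
-- words κ ∈ [N]^k (lists of indices), the coefficient of X_κ = X_{κ1} ⋯ X_{κk}.
module Series {c ℓ : Level} (R : CommutativeRing c ℓ) (N : ℕ) where
  open CommutativeRing R

  Word : Set
  Word = List (Fin N)

  PowerSeries : Set c
  PowerSeries = Word → Carrier

  Tuple : Set c
  Tuple = Fin N → PowerSeries

  Σ-list : {A : Set} → List A → (A → Carrier) → Carrier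
  Σ-list []       f = 0#
  Σ-list (x ∷ xs) f = f x + Σ-list xs f

  Π-list : List Carrier → Carrier
  Π-list []       = 1#
  Π-list (x ∷ xs) = x * Π-list xs

  Σ[N] : (Fin N → Carrier) → Carrier
  Σ[N] = Σ-list (allFin N)

  words : ℕ → List Word
  words zero    = [] ∷ []
  words (suc k) = concatMap (λ j → map (j ∷_) (words k)) (allFin N)

  splits : Word → List (Word × Word)
  splits []       = ([] , []) ∷ []
  splits (x ∷ w)  = ([] , x ∷ w) ∷ map (λ { (u , v) → (x ∷ u , v) }) (splits w)

  one : PowerSeries
  one []      = 1#
  one (_ ∷ _) = 0#

  _·_ : PowerSeries → PowerSeries → PowerSeries
  (A · B) w = Σ-list (splits w) (λ { (u , v) → A u * B v })

  monomial : Tuple → Word → PowerSeries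
  monomial G []      = one
  monomial G (j ∷ κ) = G j · monomial G κ

  -- This is well defined (a finite sum for each coefficient) when G has zero constant
  -- term, which is the case for both compositions in the theorem: then G_κ has no
  -- words of length < |κ|, so only κ with |κ| ≤ |w| contribute to the coefficient of w.
  _∘S_ : Tuple → Tuple → Tuple
  (F ∘S G) i w =
    Σ-list (upTo (suc (length w))) (λ k →
      Σ-list (words k) (λ κ → F i κ * monomial G κ w))

  Id : Tuple
  Id i []          = 0#
  Id i (j ∷ [])    with i Data.Fin.≟ j
  ... | Relation.Nullary.yes _ = 1#
  ... | Relation.Nullary.no  _ = 0#
  Id i (_ ∷ _ ∷ _) = 0#

  _≈S_ : Tuple → Tuple → Set ℓ
  F ≈S G = ∀ i w → F i w ≈ G i w

  mkF : (Fin N → Fin N → Carrier) → (Fin N → Word → Carrier) → Tuple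
  mkF P H i []            = 0#
  mkF P H i (j ∷ [])      = P i j
  mkF P H i (j ∷ l ∷ κ)   = - H i (j ∷ l ∷ κ)

  δ : Fin N → Fin N → Carrier
  δ i j = Id i (j ∷ [])

  _⊗_ : (Fin N → Fin N → Carrier) → (Fin N → Fin N → Carrier) → (Fin N → Fin N → Carrier)
  (A ⊗ B) i j = Σ[N] (λ l → A i l * B l j)

  -- Rooted planar typed trees of the class 𝔸⃗ (up to order- and type-preserving
  -- isomorphism, which for an inductive planar tree is syntactic equality).
  -- EvenV t o : a vertex of even generation, of type t, with exactly one child o.
  -- OddV: a vertex of odd generation, either a leaf of type t, or an internal vertex
  --       of type t with ordered children c₁ c₂ cs (at least two children).
  mutual
    data EvenV : Set where
      evenV : Fin N → OddV → EvenV

    data OddV : Set where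
      leafV : Fin N → OddV
      nodeV : Fin N → EvenV → EvenV → List EvenV → OddV

  typeE : EvenV → Fin N
  typeE (evenV t _) = t

  typeO : OddV → Fin N
  typeO (leafV t)         = t
  typeO (nodeV t _ _ _)   = t

  mutual
    leavesE : EvenV → Word
    leavesE (evenV _ o) = leavesO o

    leavesO : OddV → Word
    leavesO (leafV t)          = t ∷ []
    leavesO (nodeV _ c d cs)   = leavesE c ++ (leavesE d ++ leavesL cs)

    leavesL : List EvenV → Word
    leavesL []       = []
    leavesL (e ∷ es) = leavesE e ++ leavesL es

  typesL : List EvenV → Word
  typesL []       = []
  typesL (e ∷ es) = typeE e ∷ typesL es

  module Weight (Q : Fin N → Fin N → Carrier) (H : Fin N → Word → Carrier) where
    mutual
      weightE : EvenV → Carrier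
      weightE (evenV t o) = Q t (typeO o) * weightO o

      weightO : OddV → Carrier
      weightO (leafV _)          = 1#
      weightO (nodeV t c d cs)   =
        H t (typeE c ∷ typeE d ∷ typesL cs) * (weightE c * (weightE d * weightL cs))

      weightL : List EvenV → Carrier
      weightL []       = 1#
      weightL (e ∷ es) = weightE e * weightL es

-- Cutting a tree below its root (an even vertex
-- whose only child is a leaf or carries at least two subtrees) gives the fixed-point equation
-- G_i = Σ_l Q_il (X_l + H_l(G)), where H_l is the part of degree ≥ 2 of P X − F; with PQ = I
-- this is exactly F ∘ G = I. For the other side, substitution is multiplicative and hence
-- associative (both proved from the Horner form S(G) = S_∅ + Σ_j G_j · (∂_j S)(G) by induction
-- on the word length), so Y = G ∘ F satisfies Y_i = Σ_l Q_il (Σ_j P_lj X_j − H_l + H_l(Y)).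
-- Since H_l has order ≥ 2, the coefficient of Y at w only involves Y at shorter words, and
-- induction on the length of w gives Y = I.
module Submission where

open import Defs
open import Algebra.Bundles using (CommutativeRing)
open import Data.Fin using (Fin; _≟_)
open import Data.List using (List; []; _∷_; _++_; length; map; concatMap; foldr; cartesianProductWith; allFin; upTo; applyUpTo)
open import Data.List.Properties using (length-++; ∷-injective; ∷-injectiveʳ; upTo-∷ʳ; map-upTo)
open import Data.List.Relation.Unary.Any using (here; there)
open import Data.List.Relation.Unary.AllPairs using ([]; _∷_)
import Data.List.Relation.Unary.All as All
open import Data.List.Membership.Propositional using (_∈_; find; lose)
open import Data.List.Membership.Propositional.Properties
  using (∈-concatMap⁺; ∈-concatMap⁻; ∈-map⁺; ∈-map⁻; ∈-++⁻; ∈-++⁺ˡ; ∈-++⁺ʳ; ∈-allFin; ∈-upTo⁺;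
         ∈-cartesianProductWith⁺; ∈-cartesianProductWith⁻)
open import Data.List.Membership.Propositional.Properties.WithK using (unique∧set⇒bag)
open import Data.List.Relation.Unary.Unique.Propositional using (Unique)
open import Data.List.Relation.Unary.Unique.Propositional.Properties using (++⁺; map⁺; allFin⁺; upTo⁺; cartesianProductWith⁺)
open import Data.List.Relation.Binary.BagAndSetEquality using (_∼[_]_; set; ∼bag⇒↭)
open import Data.List.Relation.Binary.Permutation.Propositional using (_↭_; ↭⇒↭ₛ′)
import Data.List.Relation.Binary.Permutation.Propositional.Properties as ↭
import Data.List.Relation.Binary.Permutation.Setoid.Properties as ↭ₛ
open import Data.Nat using (ℕ; zero; suc; _≤_; _<_; s≤s; z≤n; _≤′_; ≤′-reflexive; ≤′-step)
open import Data.Nat.Properties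
  using (m≤m+n; m≤n+m; m<m+n; m<n+m; ≤-trans; ≤-pred; ≤-<-trans; <-≤-trans; <-irrefl; <⇒≤;
         n≤1+n; n<1+n; ≤⇒≤′; ≤′⇒≤; _<?_; ≮⇒≥)
open import Data.Nat.Induction using (<-wellFounded)
open import Data.Product using (Σ-syntax; ∃-syntax; _×_; _,_; proj₁; proj₂)
open import Data.Sum using (inj₁; inj₂)
open import Function using (_∘_)
open import Function.Bundles using (_⇔_; mk⇔)
import Function.Properties.Equivalence as ⇔
import Induction.WellFounded as WF
open import Level using (_⊔_)
import Relation.Binary.Construct.On as On
open import Relation.Binary.PropositionalEquality as ≡ using (_≡_; _≢_)
open import Relation.Nullary using (yes; no; contradiction)

module ListProperties where

  private
    variable
      A B : Set
      x y : A
      xs w : List A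

  ∈-concatMap-elim : ∀ (h : A → List B) xs → y ∈ concatMap h xs → ∃[ x ] (x ∈ xs × y ∈ h x)
  ∈-concatMap-elim h xs = find ∘ ∈-concatMap⁻ h

  ∈-concatMap-intro : ∀ (h : A → List B) → x ∈ xs → y ∈ h x → y ∈ concatMap h xs
  ∈-concatMap-intro h x∈ y∈ = ∈-concatMap⁺ h (lose x∈ y∈)

  concatMap⁺ : ∀ (h : A → List B) → Unique xs → (∀ {x} → x ∈ xs → Unique (h x)) →
    (∀ {x x′ y} → x ∈ xs → x′ ∈ xs → y ∈ h x → y ∈ h x′ → x ≡ x′) → Unique (concatMap h xs)
  concatMap⁺ h [] uh disjoint = []
  concatMap⁺ h (x∉ ∷ u) uh disjoint =
    ++⁺ (uh (here ≡.refl))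
        (concatMap⁺ h u (uh ∘ there) (λ x∈ x′∈ → disjoint (there x∈) (there x′∈)))
        (λ (y∈ , y∈′) → let x′ , x′∈ , y∈″ = ∈-concatMap-elim h _ y∈′
                        in All.lookup x∉ x′∈ (disjoint (here ≡.refl) (there x′∈) y∈ y∈″))

  ≤-split-left : ∀ (u v : List A) → u ++ v ≡ w → length u ≤ length w
  ≤-split-left u v ≡.refl = ≡.subst (length u ≤_) (≡.sym (length-++ u)) (m≤m+n _ _)

  ≤-split-right : ∀ (u v : List A) → u ++ v ≡ w → length v ≤ length w
  ≤-split-right u v ≡.refl = ≡.subst (length v ≤_) (≡.sym (length-++ u)) (m≤n+m _ _)

  <-split-left : ∀ (u v : List A) → 0 < length v → u ++ v ≡ w → length u < length w
  <-split-left u v 0<|v| ≡.refl = ≡.subst (length u <_) (≡.sym (length-++ u)) (m<m+n _ 0<|v|)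

  <-split-right : ∀ (u v : List A) → 0 < length u → u ++ v ≡ w → length v < length w
  <-split-right u v 0<|u| ≡.refl = ≡.subst (length v <_) (≡.sym (length-++ u)) (m<n+m _ 0<|u|)

  concatMap⁺-tagged : ∀ (h : A → List B) (tag : B → A) → Unique xs → (∀ {x} → x ∈ xs → Unique (h x)) →
    (∀ {x y} → x ∈ xs → y ∈ h x → tag y ≡ x) → Unique (concatMap h xs)
  concatMap⁺-tagged h tag uxs uh tag-correct =
    concatMap⁺ h uxs uh (λ x∈ x′∈ y∈ y∈′ → ≡.trans (≡.sym (tag-correct x∈ y∈)) (tag-correct x′∈ y∈′))

open ListProperties

module SumProperties {c ℓ} (R : CommutativeRing c ℓ) (N : ℕ) where
  open CommutativeRing R
  open Series R N
  open import Relation.Binary.Reasoning.Setoid setoid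
  open import Algebra.Properties.CommutativeSemigroup +-commutativeSemigroup using (interchange)
  open import Algebra.Properties.Group +-group using (ε⁻¹≈ε)

  private
    variable
      A B C : Set
      xs ys : List A
      f g : A → Carrier

  Σ-cong : ∀ (xs : List A) → (∀ x → f x ≈ g x) → Σ-list xs f ≈ Σ-list xs g
  Σ-cong []       f≈g = refl
  Σ-cong (x ∷ xs) f≈g = +-cong (f≈g x) (Σ-cong xs f≈g)

  Σ-cong-∈ : ∀ (xs : List A) → (∀ x → x ∈ xs → f x ≈ g x) → Σ-list xs f ≈ Σ-list xs g
  Σ-cong-∈ []       f≈g = refl
  Σ-cong-∈ (x ∷ xs) f≈g = +-cong (f≈g x (here ≡.refl)) (Σ-cong-∈ xs (λ y y∈ → f≈g y (there y∈)))

  Σ-zero : ∀ (xs : List A) → (∀ x → x ∈ xs → f x ≈ 0#) → Σ-list xs f ≈ 0#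
  Σ-zero xs f≈0 = trans (Σ-cong-∈ xs f≈0) (Σ-zero-const xs)
    where
      Σ-zero-const : ∀ (xs : List A) → Σ-list xs (λ _ → 0#) ≈ 0#
      Σ-zero-const []       = refl
      Σ-zero-const (x ∷ xs) = trans (+-identityˡ _) (Σ-zero-const xs)

  Σ-++ : ∀ (xs ys : List A) (f : A → Carrier) → Σ-list (xs ++ ys) f ≈ Σ-list xs f + Σ-list ys f
  Σ-++ []       ys f = sym (+-identityˡ _)
  Σ-++ (x ∷ xs) ys f = trans (+-cong refl (Σ-++ xs ys f)) (sym (+-assoc _ _ _))

  Σ-map : ∀ (h : A → B) (xs : List A) (f : B → Carrier) → Σ-list (map h xs) f ≈ Σ-list xs (λ x → f (h x))
  Σ-map h []       f = refl
  Σ-map h (x ∷ xs) f = +-cong refl (Σ-map h xs f)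

  Σ-concatMap : ∀ (h : A → List B) (xs : List A) (f : B → Carrier) →
    Σ-list (concatMap h xs) f ≈ Σ-list xs (λ x → Σ-list (h x) f)
  Σ-concatMap h []       f = refl
  Σ-concatMap h (x ∷ xs) f = trans (Σ-++ (h x) (concatMap h xs) f) (+-cong refl (Σ-concatMap h xs f))

  Σ-+ : ∀ (xs : List A) (f g : A → Carrier) → Σ-list xs (λ x → f x + g x) ≈ Σ-list xs f + Σ-list xs g
  Σ-+ []       f g = sym (+-identityˡ 0#)
  Σ-+ (x ∷ xs) f g = trans (+-cong refl (Σ-+ xs f g)) (interchange _ _ _ _)

  *-distribˡ-Σ : ∀ (xs : List A) (a : Carrier) (f : A → Carrier) → a * Σ-list xs f ≈ Σ-list xs (λ x → a * f x)
  *-distribˡ-Σ []       a f = zeroʳ a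
  *-distribˡ-Σ (x ∷ xs) a f = trans (distribˡ a _ _) (+-cong refl (*-distribˡ-Σ xs a f))

  *-distribʳ-Σ : ∀ (xs : List A) (a : Carrier) (f : A → Carrier) → Σ-list xs f * a ≈ Σ-list xs (λ x → f x * a)
  *-distribʳ-Σ []       a f = zeroˡ a
  *-distribʳ-Σ (x ∷ xs) a f = trans (distribʳ a _ _) (+-cong refl (*-distribʳ-Σ xs a f))

  -‿distrib-Σ : ∀ (xs : List A) (f : A → Carrier) → Σ-list xs (λ x → - f x) ≈ - Σ-list xs f
  -‿distrib-Σ []       f = sym ε⁻¹≈ε
  -‿distrib-Σ (x ∷ xs) f = trans (+-cong refl (-‿distrib-Σ xs f)) (⁻¹-∙-comm (f x) _)
    where open import Algebra.Properties.AbelianGroup +-abelianGroup using (⁻¹-∙-comm)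

  Σ-comm : ∀ (xs : List A) (ys : List B) (f : A → B → Carrier) →
    Σ-list xs (λ x → Σ-list ys (f x)) ≈ Σ-list ys (λ y → Σ-list xs (λ x → f x y))
  Σ-comm []       ys f = sym (Σ-zero ys (λ _ _ → refl))
  Σ-comm (x ∷ xs) ys f = trans (+-cong refl (Σ-comm xs ys f)) (sym (Σ-+ ys (f x) _))

  Σ-only : ∀ (xs : List A) {j : A} (f : A → Carrier) → Unique xs → j ∈ xs →
    (∀ x → x ∈ xs → x ≢ j → f x ≈ 0#) → Σ-list xs f ≈ f j
  Σ-only (x ∷ xs) f (x∉ ∷ _) (here ≡.refl) others =
    trans (+-cong refl (Σ-zero xs (λ y y∈ → others y (there y∈) (λ { ≡.refl → All.lookup x∉ y∈ ≡.refl }))))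
          (+-identityʳ _)
  Σ-only (x ∷ xs) f (x∉ ∷ u) (there j∈) others =
    trans (+-cong (others x (here ≡.refl) (λ { ≡.refl → All.lookup x∉ j∈ ≡.refl }))
                  (Σ-only xs f u j∈ (λ y y∈ → others y (there y∈))))
          (+-identityˡ _)

  Σ-↭ : ∀ (f : A → Carrier) → xs ↭ ys → Σ-list xs f ≈ Σ-list ys f
  Σ-↭ {xs = xs} {ys} f xs↭ys = begin
    Σ-list xs f                ≡⟨ Σ-as-foldr xs ⟩
    foldr _+_ 0# (map f xs)    ≈⟨ ↭ₛ.foldr-commMonoid setoid +-isCommutativeMonoid
                                    (↭⇒↭ₛ′ isEquivalence (↭.map⁺ f xs↭ys)) ⟩
    foldr _+_ 0# (map f ys)    ≡⟨ Σ-as-foldr ys ⟨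
    Σ-list ys f                ∎
    where
      Σ-as-foldr : ∀ xs → Σ-list xs f ≡ foldr _+_ 0# (map f xs)
      Σ-as-foldr []       = ≡.refl
      Σ-as-foldr (x ∷ xs) = ≡.cong (f x +_) (Σ-as-foldr xs)

  Σ-∼set : ∀ (f : A → Carrier) → Unique xs → Unique ys → xs ∼[ set ] ys → Σ-list xs f ≈ Σ-list ys f
  Σ-∼set f uxs uys xs∼ys = Σ-↭ f (∼bag⇒↭ (unique∧set⇒bag uxs uys xs∼ys))

  Σ-upTo-suc : ∀ n (T : ℕ → Carrier) → Σ-list (upTo (suc n)) T ≈ Σ-list (upTo n) T + T n
  Σ-upTo-suc n T = begin
    Σ-list (upTo (suc n)) T         ≡⟨ ≡.cong (λ ks → Σ-list ks T) (upTo-∷ʳ n) ⟨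
    Σ-list (upTo n ++ n ∷ []) T     ≈⟨ Σ-++ (upTo n) (n ∷ []) T ⟩
    Σ-list (upTo n) T + (T n + 0#)  ≈⟨ +-cong refl (+-identityʳ _) ⟩
    Σ-list (upTo n) T + T n         ∎

  Σ-upTo-suc′ : ∀ n (T : ℕ → Carrier) → Σ-list (upTo (suc n)) T ≈ T 0 + Σ-list (upTo n) (T ∘ suc)
  Σ-upTo-suc′ n T = +-cong refl (begin
    Σ-list (applyUpTo suc n) T ≡⟨ ≡.cong (λ ks → Σ-list ks T) (map-upTo suc n) ⟨
    Σ-list (map suc (upTo n)) T ≈⟨ Σ-map suc (upTo n) T ⟩
    Σ-list (upTo n) (T ∘ suc) ∎)

  Σ-cartesianProductWith : ∀ (h : A → B → C) (xs : List A) (ys : List B) (f : C → Carrier) →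
    Σ-list (cartesianProductWith h xs ys) f ≈ Σ-list xs (λ x → Σ-list ys (λ y → f (h x y)))
  Σ-cartesianProductWith h []       ys f = refl
  Σ-cartesianProductWith h (x ∷ xs) ys f = begin
    Σ-list (map (h x) ys ++ cartesianProductWith h xs ys) f
      ≈⟨ Σ-++ (map (h x) ys) _ f ⟩
    Σ-list (map (h x) ys) f + Σ-list (cartesianProductWith h xs ys) f
      ≈⟨ +-cong (Σ-map (h x) ys f) (Σ-cartesianProductWith h xs ys f) ⟩
    Σ-list ys (λ y → f (h x y)) + Σ-list xs (λ x → Σ-list ys (λ y → f (h x y))) ∎

module WordProperties {c ℓ} (R : CommutativeRing c ℓ) (N : ℕ) where
  open Series R N

  splits-sound : ∀ w {p} → p ∈ splits w → proj₁ p ++ proj₂ p ≡ w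
  splits-sound []      (here ≡.refl) = ≡.refl
  splits-sound (x ∷ w) (here ≡.refl) = ≡.refl
  splits-sound (x ∷ w) (there p∈) with ∈-map⁻ _ p∈
  ... | q , q∈ , ≡.refl = ≡.cong (x ∷_) (splits-sound w q∈)

  ∈-splits : ∀ u v → (u , v) ∈ splits (u ++ v)
  ∈-splits []      []      = here ≡.refl
  ∈-splits []      (x ∷ v) = here ≡.refl
  ∈-splits (x ∷ u) v       = there (∈-map⁺ _ (∈-splits u v))

  splits-unique : ∀ w → Unique (splits w)
  splits-unique []      = All.[] ∷ []
  splits-unique (x ∷ w) = All.tabulate first-nonempty ∷ map⁺ extend-injective (splits-unique w)
    where
      first-nonempty : ∀ {p} → p ∈ map _ (splits w) → ([] , x ∷ w) ≢ p
      first-nonempty p∈ eq with ∈-map⁻ _ p∈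
      first-nonempty p∈ () | _ , _ , ≡.refl
      extend-injective : ∀ {p q : Word × Word} → (x ∷ proj₁ p , proj₂ p) ≡ (x ∷ proj₁ q , proj₂ q) → p ≡ q
      extend-injective eq = ≡.cong₂ _,_ (∷-injectiveʳ (≡.cong proj₁ eq)) (≡.cong proj₂ eq)

  words-length : ∀ k {κ} → κ ∈ words k → length κ ≡ k
  words-length zero    (here ≡.refl) = ≡.refl
  words-length (suc k) κ∈ with ∈-concatMap-elim (λ j → map (j ∷_) (words k)) (allFin N) κ∈
  ... | j , _ , κ∈′ with ∈-map⁻ (j ∷_) κ∈′
  ... | κ′ , κ′∈ , ≡.refl = ≡.cong suc (words-length k κ′∈)

  ∈-words : ∀ κ → κ ∈ words (length κ)
  ∈-words []      = here ≡.refl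
  ∈-words (j ∷ κ) = ∈-concatMap-intro (λ j → map (j ∷_) (words (length κ))) (∈-allFin j) (∈-map⁺ _ (∈-words κ))

  words-unique : ∀ k → Unique (words k)
  words-unique zero    = All.[] ∷ []
  words-unique (suc k) = concatMap⁺ (λ j → map (j ∷_) (words k)) (allFin⁺ N) (λ _ → map⁺ ∷-injectiveʳ (words-unique k)) same-head
    where
      same-head : ∀ {j j′ κ} → j ∈ allFin N → j′ ∈ allFin N →
        κ ∈ map (j ∷_) (words k) → κ ∈ map (j′ ∷_) (words k) → j ≡ j′
      same-head _ _ κ∈ κ∈′ with ∈-map⁻ _ κ∈ | ∈-map⁻ _ κ∈′
      ... | _ , _ , ≡.refl | _ , _ , eq = proj₁ (∷-injective eq)

  length-induction : ∀ {p} (P : Word → Set p) →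
    (∀ w → (∀ {v} → length v < length w → P v) → P w) → ∀ w → P w
  length-induction {p} = WF.All.wfRec (On.wellFounded length <-wellFounded) p

module ProductProperties {c ℓ} (R : CommutativeRing c ℓ) (N : ℕ) where
  open CommutativeRing R
  open Series R N
  open SumProperties R N
  open WordProperties R N
  open import Relation.Binary.Reasoning.Setoid setoid
  open import Algebra.Properties.CommutativeSemigroup *-commutativeSemigroup using (x∙yz≈y∙xz)

  infix 4 _≋_
  _≋_ : PowerSeries → PowerSeries → Set ℓ
  A ≋ B = ∀ w → A w ≈ B w

  ∂ : Fin N → PowerSeries → PowerSeries
  ∂ j A κ = A (j ∷ κ)

  ·-cong : ∀ {A A′ B B′} → A ≋ A′ → B ≋ B′ → A · B ≋ A′ · B′
  ·-cong A≋A′ B≋B′ w = Σ-cong (splits w) (λ p → *-cong (A≋A′ (proj₁ p)) (B≋B′ (proj₂ p)))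

  one-· : ∀ A → one · A ≋ A
  one-· A []      = trans (+-identityʳ _) (*-identityˡ _)
  one-· A (x ∷ w) = begin
    1# * A (x ∷ w) + Σ-list (map _ (splits w)) _ ≈⟨ +-cong (*-identityˡ _) (Σ-map _ (splits w) _) ⟩
    A (x ∷ w) + Σ-list (splits w) (λ p → 0# * A (proj₂ p)) ≈⟨ +-cong refl (Σ-zero (splits w) (λ _ _ → zeroˡ _)) ⟩
    A (x ∷ w) + 0#                                ≈⟨ +-identityʳ _ ⟩
    A (x ∷ w)                                     ∎

  ·-one : ∀ A → A · one ≋ A
  ·-one A []      = trans (+-identityʳ _) (*-identityʳ _)
  ·-one A (x ∷ w) = begin
    A [] * 0# + Σ-list (map _ (splits w)) _ ≈⟨ +-cong (zeroʳ _) (Σ-map _ (splits w) _) ⟩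
    0# + (∂ x A · one) w                    ≈⟨ +-identityˡ _ ⟩
    (∂ x A · one) w                         ≈⟨ ·-one (∂ x A) w ⟩
    A (x ∷ w)                               ∎

  ∂-· : ∀ j A B κ → ∂ j (A · B) κ ≈ A [] * ∂ j B κ + (∂ j A · B) κ
  ∂-· j A B κ = +-cong refl (Σ-map _ (splits κ) _)

  ·-+ʳ : ∀ A X Y w → (A · (λ v → X v + Y v)) w ≈ (A · X) w + (A · Y) w
  ·-+ʳ A X Y w = trans (Σ-cong (splits w) (λ p → distribˡ _ _ _)) (Σ-+ (splits w) _ _)

  ·-+ˡ : ∀ X Y B w → ((λ u → X u + Y u) · B) w ≈ (X · B) w + (Y · B) w
  ·-+ˡ X Y B w = trans (Σ-cong (splits w) (λ p → distribʳ _ _ _)) (Σ-+ (splits w) _ _)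

  ·-*ʳ : ∀ A a X w → (A · (λ v → a * X v)) w ≈ a * (A · X) w
  ·-*ʳ A a X w = begin
    Σ-list (splits w) (λ p → A (proj₁ p) * (a * X (proj₂ p))) ≈⟨ Σ-cong (splits w) (λ p → x∙yz≈y∙xz _ _ _) ⟩
    Σ-list (splits w) (λ p → a * (A (proj₁ p) * X (proj₂ p))) ≈⟨ *-distribˡ-Σ (splits w) a _ ⟨
    a * (A · X) w                                            ∎

  ·-*ˡ : ∀ a X B w → ((λ u → a * X u) · B) w ≈ a * (X · B) w
  ·-*ˡ a X B w = trans (Σ-cong (splits w) (λ p → *-assoc _ _ _)) (sym (*-distribˡ-Σ (splits w) a _))

  ·-Σʳ : ∀ {I : Set} A (is : List I) (X : I → PowerSeries) w →
    (A · (λ v → Σ-list is (λ i → X i v))) w ≈ Σ-list is (λ i → (A · X i) w)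
  ·-Σʳ A is X w = begin
    Σ-list (splits w) (λ p → A (proj₁ p) * Σ-list is (λ i → X i (proj₂ p)))
      ≈⟨ Σ-cong (splits w) (λ p → *-distribˡ-Σ is _ _) ⟩
    Σ-list (splits w) (λ p → Σ-list is (λ i → A (proj₁ p) * X i (proj₂ p)))
      ≈⟨ Σ-comm (splits w) is _ ⟩
    Σ-list is (λ i → (A · X i) w) ∎

  ·-Σˡ : ∀ {I : Set} (is : List I) (X : I → PowerSeries) B w →
    ((λ u → Σ-list is (λ i → X i u)) · B) w ≈ Σ-list is (λ i → (X i · B) w)
  ·-Σˡ is X B w = begin
    Σ-list (splits w) (λ p → Σ-list is (λ i → X i (proj₁ p)) * B (proj₂ p))
      ≈⟨ Σ-cong (splits w) (λ p → *-distribʳ-Σ is _ _) ⟩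
    Σ-list (splits w) (λ p → Σ-list is (λ i → X i (proj₁ p) * B (proj₂ p)))
      ≈⟨ Σ-comm (splits w) is _ ⟩
    Σ-list is (λ i → (X i · B) w) ∎

  -- Both sides sum f over all factorisations w = a ++ b ++ c.
  splits-assoc : ∀ w (f : Word → Word → Word → Carrier) →
    Σ-list (splits w) (λ p → Σ-list (splits (proj₁ p)) (λ q → f (proj₁ q) (proj₂ q) (proj₂ p))) ≈
    Σ-list (splits w) (λ p → Σ-list (splits (proj₂ p)) (λ q → f (proj₁ p) (proj₁ q) (proj₂ q)))
  splits-assoc []      f = refl
  splits-assoc (x ∷ w) f = begin
    (f [] [] (x ∷ w) + 0#) + Σ-list (map _ (splits w)) _
      ≈⟨ +-cong (+-identityʳ _) (trans (Σ-map _ (splits w) _)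
           (trans (Σ-cong (splits w) (λ p → +-cong refl (Σ-map _ (splits (proj₁ p)) _))) (Σ-+ (splits w) _ _))) ⟩
    f [] [] (x ∷ w) + (S₀ + Sˡ) ≈⟨ +-cong refl (+-cong refl (splits-assoc w g)) ⟩
    f [] [] (x ∷ w) + (S₀ + Sʳ) ≈⟨ +-assoc _ _ _ ⟨
    (f [] [] (x ∷ w) + S₀) + Sʳ ≈⟨ +-cong (+-cong refl (Σ-map _ (splits w) _)) (Σ-map _ (splits w) _) ⟨
    (f [] [] (x ∷ w) + Σ-list (map _ (splits w)) _) + Σ-list (map _ (splits w)) _ ∎
    where
      g : Word → Word → Word → Carrier
      g a b c′ = f (x ∷ a) b c′

      S₀ Sˡ Sʳ : Carrier
      S₀ = Σ-list (splits w) (λ p → f [] (x ∷ proj₁ p) (proj₂ p))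
      Sˡ = Σ-list (splits w) (λ p → Σ-list (splits (proj₁ p)) (λ q → g (proj₁ q) (proj₂ q) (proj₂ p)))
      Sʳ = Σ-list (splits w) (λ p → Σ-list (splits (proj₂ p)) (λ q → g (proj₁ p) (proj₁ q) (proj₂ q)))

  ·-assoc : ∀ A B C → (A · B) · C ≋ A · (B · C)
  ·-assoc A B C w = begin
    Σ-list (splits w) (λ p → (A · B) (proj₁ p) * C (proj₂ p))
      ≈⟨ Σ-cong (splits w) (λ p → *-distribʳ-Σ (splits (proj₁ p)) _ _) ⟩
    Σ-list (splits w) (λ p → Σ-list (splits (proj₁ p)) (λ q → (A (proj₁ q) * B (proj₂ q)) * C (proj₂ p)))
      ≈⟨ splits-assoc w (λ a b c′ → (A a * B b) * C c′) ⟩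
    Σ-list (splits w) (λ p → Σ-list (splits (proj₂ p)) (λ q → (A (proj₁ p) * B (proj₁ q)) * C (proj₂ q)))
      ≈⟨ Σ-cong (splits w) (λ p → trans (Σ-cong (splits (proj₂ p)) (λ q → *-assoc _ _ _))
                                          (sym (*-distribˡ-Σ (splits (proj₂ p)) _ _))) ⟩
    Σ-list (splits w) (λ p → A (proj₁ p) * (B · C) (proj₂ p)) ∎

  ·-local : ∀ A {X Y} w → A [] ≈ 0# → (∀ {v} → length v < length w → X v ≈ Y v) → (A · X) w ≈ (A · Y) w
  ·-local A {X} {Y} w A₀ X≈Y = Σ-cong-∈ (splits w) (λ p p∈ → factor (proj₁ p) (proj₂ p) (splits-sound w p∈))
    where
      factor : ∀ u v → u ++ v ≡ w → A u * X v ≈ A u * Y v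
      factor []      v eq = trans (*-cong A₀ refl) (trans (zeroˡ _) (sym (trans (*-cong A₀ refl) (zeroˡ _))))
      factor (a ∷ u) v eq = *-cong refl (X≈Y (<-split-right (a ∷ u) v (s≤s z≤n) eq))

module DeltaProperties {c ℓ} (R : CommutativeRing c ℓ) (N : ℕ) where
  open CommutativeRing R
  open Series R N
  open SumProperties R N

  δ-refl : ∀ j → δ j j ≈ 1#
  δ-refl j with j ≟ j
  ... | yes _ = refl
  ... | no j≢j = contradiction ≡.refl j≢j

  δ-≢ : ∀ {i j} → i ≢ j → δ i j ≈ 0#
  δ-≢ {i} {j} i≢j with i ≟ j
  ... | yes i≡j = contradiction i≡j i≢j
  ... | no _    = refl

  Σ-δˡ : ∀ i (f : Fin N → Carrier) → Σ[N] (λ j → δ i j * f j) ≈ f i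
  Σ-δˡ i f = trans (Σ-only (allFin N) _ (allFin⁺ N) (∈-allFin i)
                     (λ j _ j≢i → trans (*-cong (δ-≢ (j≢i ∘ ≡.sym)) refl) (zeroˡ _)))
                   (trans (*-cong (δ-refl i) refl) (*-identityˡ _))

  Σ-δʳ : ∀ i (f : Fin N → Carrier) → Σ[N] (λ j → δ j i * f j) ≈ f i
  Σ-δʳ i f = trans (Σ-only (allFin N) _ (allFin⁺ N) (∈-allFin i)
                     (λ j _ j≢i → trans (*-cong (δ-≢ j≢i) refl) (zeroˡ _)))
                   (trans (*-cong (δ-refl i) refl) (*-identityˡ _))

  Σ-inverse : ∀ {A B : Fin N → Fin N → Carrier} → (∀ i j → (A ⊗ B) i j ≈ δ i j) →
    ∀ i (x : Fin N → Carrier) → Σ[N] (λ j → A i j * Σ[N] (λ l → B j l * x l)) ≈ x i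
  Σ-inverse {A} {B} AB≈δ i x = begin
    Σ[N] (λ j → A i j * Σ[N] (λ l → B j l * x l))   ≈⟨ Σ-cong (allFin N) (λ j → *-distribˡ-Σ (allFin N) _ _) ⟩
    Σ[N] (λ j → Σ[N] (λ l → A i j * (B j l * x l))) ≈⟨ Σ-comm (allFin N) (allFin N) _ ⟩
    Σ[N] (λ l → Σ[N] (λ j → A i j * (B j l * x l))) ≈⟨ Σ-cong (allFin N) (λ l → Σ-cong (allFin N) (λ j → *-assoc _ _ _)) ⟨
    Σ[N] (λ l → Σ[N] (λ j → (A i j * B j l) * x l)) ≈⟨ Σ-cong (allFin N) (λ l → *-distribʳ-Σ (allFin N) _ _) ⟨
    Σ[N] (λ l → (A ⊗ B) i l * x l)                  ≈⟨ Σ-cong (allFin N) (λ l → *-cong (AB≈δ i l) refl) ⟩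
    Σ[N] (λ l → δ i l * x l)                        ≈⟨ Σ-δˡ i x ⟩
    x i                                              ∎
    where open import Relation.Binary.Reasoning.Setoid setoid

module SubstitutionProperties {c ℓ} (R : CommutativeRing c ℓ) (N : ℕ) where
  open CommutativeRing R
  open Series R N
  open SumProperties R N
  open WordProperties R N
  open ProductProperties R N
  open DeltaProperties R N
  open import Relation.Binary.Reasoning.Setoid setoid

  OrderAtLeast : ℕ → PowerSeries → Set ℓ
  OrderAtLeast k S = ∀ κ → length κ < k → S κ ≈ 0#

  NoConstantTerm : Tuple → Set ℓ
  NoConstantTerm G = ∀ j → G j [] ≈ 0#

  AgreeBelow : ℕ → Tuple → Tuple → Set ℓ
  AgreeBelow n G G′ = ∀ j u → length u < n → G j u ≈ G′ j u

  private
    variable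
      G G′ : Tuple

  *-zeroˡ′ : ∀ {a} b → a ≈ 0# → a * b ≈ 0#
  *-zeroˡ′ b a≈0 = trans (*-cong a≈0 refl) (zeroˡ b)

  *-zeroʳ′ : ∀ a {b} → b ≈ 0# → a * b ≈ 0#
  *-zeroʳ′ a b≈0 = trans (*-cong refl b≈0) (zeroʳ a)

  monomial-order : NoConstantTerm G → ∀ μ → OrderAtLeast (length μ) (monomial G μ)
  monomial-order {G} G₀ (a ∷ μ) w |w|≤|μ| = Σ-zero (splits w) (λ p p∈ → term (proj₁ p) (proj₂ p) (splits-sound w p∈))
    where
      term : ∀ u v → u ++ v ≡ w → G a u * monomial G μ v ≈ 0#
      term []      v _  = *-zeroˡ′ _ (G₀ a)
      term (b ∷ u) v eq = *-zeroʳ′ _ (monomial-order G₀ μ v (<-≤-trans (<-split-right (b ∷ u) v (s≤s z≤n) eq) (≤-pred |w|≤|μ|)))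

  monomial-local : ∀ {n} → AgreeBelow n G G′ → ∀ μ {w} → length w < n → monomial G μ w ≈ monomial G′ μ w
  monomial-local G≈G′ []      |w|<n = refl
  monomial-local {G} {G′} G≈G′ (a ∷ μ) {w} |w|<n =
    Σ-cong-∈ (splits w) (λ p p∈ → factors (proj₁ p) (proj₂ p) (splits-sound w p∈))
    where
      factors : ∀ u v → u ++ v ≡ w → G a u * monomial G μ v ≈ G′ a u * monomial G′ μ v
      factors u v eq = *-cong (G≈G′ a u (≤-<-trans (≤-split-left u v eq) |w|<n))
                              (monomial-local G≈G′ μ (≤-<-trans (≤-split-right u v eq) |w|<n))

  -- Each of the at least two factors is evaluated on a proper subword or on [].
  monomial-local-strict : NoConstantTerm G → NoConstantTerm G′ → ∀ {w} → AgreeBelow (length w) G G′ →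
    ∀ a b μ → monomial G (a ∷ b ∷ μ) w ≈ monomial G′ (a ∷ b ∷ μ) w
  monomial-local-strict {G} {G′} G₀ G′₀ {w} G≈G′ a b μ =
    Σ-cong-∈ (splits w) (λ p p∈ → factors (proj₁ p) (proj₂ p) (splits-sound w p∈))
    where
      factors : ∀ u v → u ++ v ≡ w → G a u * monomial G (b ∷ μ) v ≈ G′ a u * monomial G′ (b ∷ μ) v
      factors []      v       _  = trans (*-zeroˡ′ _ (G₀ a)) (sym (*-zeroˡ′ _ (G′₀ a)))
      factors (c ∷ u) []      _  = trans (*-zeroʳ′ _ (monomial-order G₀ (b ∷ μ) [] (s≤s z≤n)))
                                         (sym (*-zeroʳ′ _ (monomial-order G′₀ (b ∷ μ) [] (s≤s z≤n))))
      factors (c ∷ u) (d ∷ v) eq = *-cong (G≈G′ a (c ∷ u) (<-split-left (c ∷ u) (d ∷ v) (s≤s z≤n) eq))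
                                          (monomial-local G≈G′ (b ∷ μ) (<-split-right (c ∷ u) (d ∷ v) (s≤s z≤n) eq))

  infixl 8 _⊚_

  _⊚[_]_ : PowerSeries → ℕ → Tuple → PowerSeries
  (S ⊚[ m ] G) w = Σ-list (upTo (suc m)) (λ k → Σ-list (words k) (λ κ → S κ * monomial G κ w))

  -- (F ∘S G) i and F i ⊚ G are definitionally equal.
  _⊚_ : PowerSeries → Tuple → PowerSeries
  (S ⊚ G) w = (S ⊚[ length w ] G) w

  ⊚-constant : ∀ S G → (S ⊚ G) [] ≈ S []
  ⊚-constant S G = trans (+-identityʳ _) (trans (+-identityʳ _) (*-identityʳ _))

  ⊚[]-suc : NoConstantTerm G → ∀ S {m w} → length w ≤ m → (S ⊚[ suc m ] G) w ≈ (S ⊚[ m ] G) w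
  ⊚[]-suc {G} G₀ S {m} {w} |w|≤m = begin
    (S ⊚[ suc m ] G) w ≈⟨ Σ-upTo-suc (suc m) _ ⟩
    (S ⊚[ m ] G) w + Σ-list (words (suc m)) (λ κ → S κ * monomial G κ w)
      ≈⟨ +-cong refl (Σ-zero (words (suc m)) (λ κ κ∈ → *-zeroʳ′ _ (monomial-order G₀ κ w
           (≡.subst (length w <_) (≡.sym (words-length (suc m) κ∈)) (s≤s |w|≤m))))) ⟩
    (S ⊚[ m ] G) w + 0# ≈⟨ +-identityʳ _ ⟩
    (S ⊚[ m ] G) w ∎

  ⊚[]-extend : NoConstantTerm G → ∀ S {m w} → length w ≤ m → (S ⊚[ m ] G) w ≈ (S ⊚ G) w
  ⊚[]-extend {G} G₀ S |w|≤m = go (≤⇒≤′ |w|≤m)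
    where
      go : ∀ {m w} → length w ≤′ m → (S ⊚[ m ] G) w ≈ (S ⊚ G) w
      go (≤′-reflexive ≡.refl) = refl
      go (≤′-step |w|≤′m)      = trans (⊚[]-suc G₀ S (≤′⇒≤ |w|≤′m)) (go |w|≤′m)

  ⊚[]-horner : ∀ S G m w → (S ⊚[ suc m ] G) w ≈ S [] * one w + Σ[N] (λ j → (G j · (∂ j S ⊚[ m ] G)) w)
  ⊚[]-horner S G m w = trans (Σ-upTo-suc′ (suc m) _) (+-cong (+-identityʳ _) (begin
    Σ-list (upTo (suc m)) (λ k → Σ-list (words (suc k)) (λ κ → S κ * monomial G κ w))
      ≈⟨ Σ-cong (upTo (suc m)) (λ k → trans (Σ-concatMap _ (allFin N) _) (Σ-cong (allFin N) (λ j → Σ-map _ (words k) _))) ⟩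
    Σ-list (upTo (suc m)) (λ k → Σ[N] (λ j → Σ-list (words k) (λ κ → ∂ j S κ * (G j · monomial G κ) w)))
      ≈⟨ Σ-comm (upTo (suc m)) (allFin N) _ ⟩
    Σ[N] (λ j → Σ-list (upTo (suc m)) (λ k → Σ-list (words k) (λ κ → ∂ j S κ * (G j · monomial G κ) w)))
      ≈⟨ Σ-cong (allFin N) (λ j → Σ-cong (upTo (suc m)) (λ k → Σ-cong (words k) (λ κ → ·-*ʳ (G j) _ (monomial G κ) w))) ⟨
    Σ[N] (λ j → Σ-list (upTo (suc m)) (λ k → Σ-list (words k) (λ κ → (G j · (λ v → ∂ j S κ * monomial G κ v)) w)))
      ≈⟨ Σ-cong (allFin N) (λ j → Σ-cong (upTo (suc m)) (λ k → ·-Σʳ (G j) (words k) _ w)) ⟨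
    Σ[N] (λ j → Σ-list (upTo (suc m)) (λ k → (G j · (λ v → Σ-list (words k) (λ κ → ∂ j S κ * monomial G κ v))) w))
      ≈⟨ Σ-cong (allFin N) (λ j → ·-Σʳ (G j) (upTo (suc m)) _ w) ⟨
    Σ[N] (λ j → (G j · (∂ j S ⊚[ m ] G)) w) ∎))

  ⊚-horner : NoConstantTerm G → ∀ S w → (S ⊚ G) w ≈ S [] * one w + Σ[N] (λ j → (G j · (∂ j S ⊚ G)) w)
  ⊚-horner {G} G₀ S [] = begin
    (S ⊚ G) []     ≈⟨ ⊚-constant S G ⟩
    S []           ≈⟨ *-identityʳ _ ⟨
    S [] * 1#      ≈⟨ +-identityʳ _ ⟨
    S [] * 1# + 0# ≈⟨ +-cong refl (Σ-zero (allFin N) (λ j _ → trans (+-identityʳ _) (*-zeroˡ′ _ (G₀ j)))) ⟨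
    S [] * one [] + Σ[N] (λ j → (G j · (∂ j S ⊚ G)) []) ∎
  ⊚-horner {G} G₀ S (x ∷ w) = trans (⊚[]-horner S G (length w) (x ∷ w))
    (+-cong refl (Σ-cong (allFin N) (λ j → ·-local (G j) (x ∷ w) (G₀ j) (λ |v|<|xw| →
      ⊚[]-extend G₀ (∂ j S) (≤-pred |v|<|xw|)))))

  ⊚-cong : ∀ {S S′} G → S ≋ S′ → S ⊚ G ≋ S′ ⊚ G
  ⊚-cong G S≋S′ w = Σ-cong (upTo (suc (length w))) (λ k → Σ-cong (words k) (λ κ → *-cong (S≋S′ κ) refl))

  ⊚-+ : ∀ S T G w → ((λ κ → S κ + T κ) ⊚ G) w ≈ (S ⊚ G) w + (T ⊚ G) w
  ⊚-+ S T G w = trans (Σ-cong (upTo (suc (length w))) (λ k →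
                         trans (Σ-cong (words k) (λ κ → distribʳ _ _ _)) (Σ-+ (words k) _ _)))
                       (Σ-+ (upTo (suc (length w))) _ _)

  ⊚-* : ∀ a S G w → ((λ κ → a * S κ) ⊚ G) w ≈ a * (S ⊚ G) w
  ⊚-* a S G w = sym (trans (*-distribˡ-Σ (upTo (suc (length w))) a _)
    (Σ-cong (upTo (suc (length w))) (λ k → trans (*-distribˡ-Σ (words k) a _) (Σ-cong (words k) (λ κ → sym (*-assoc _ _ _))))))

  ⊚-neg : ∀ S G w → ((λ κ → - S κ) ⊚ G) w ≈ - (S ⊚ G) w
  ⊚-neg S G w = trans (Σ-cong (upTo (suc (length w))) (λ k →
                         trans (Σ-cong (words k) (λ κ → sym (-‿distribˡ-* _ _))) (-‿distrib-Σ (words k) _)))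
                       (-‿distrib-Σ (upTo (suc (length w))) _)
    where open import Algebra.Properties.Ring ring using (-‿distribˡ-*)

  ⊚-Σ : ∀ {I : Set} (is : List I) (S : I → PowerSeries) G w →
    ((λ κ → Σ-list is (λ i → S i κ)) ⊚ G) w ≈ Σ-list is (λ i → (S i ⊚ G) w)
  ⊚-Σ is S G w = begin
    Σ-list U (λ k → Σ-list (words k) (λ κ → Σ-list is (λ i → S i κ) * monomial G κ w))
      ≈⟨ Σ-cong U (λ k → Σ-cong (words k) (λ κ → *-distribʳ-Σ is _ _)) ⟩
    Σ-list U (λ k → Σ-list (words k) (λ κ → Σ-list is (λ i → S i κ * monomial G κ w)))
      ≈⟨ Σ-cong U (λ k → Σ-comm (words k) is _) ⟩
    Σ-list U (λ k → Σ-list is (λ i → Σ-list (words k) (λ κ → S i κ * monomial G κ w)))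
      ≈⟨ Σ-comm U is _ ⟩
    Σ-list is (λ i → (S i ⊚ G) w) ∎
    where
      U : List ℕ
      U = upTo (suc (length w))

  ⊚-one : ∀ G → one ⊚ G ≋ one
  ⊚-one G w = begin
    (one ⊚ G) w ≈⟨ Σ-upTo-suc′ (length w) _ ⟩
    (1# * one w + 0#) + Σ-list (upTo (length w)) (λ k → Σ-list (words (suc k)) (λ κ → one κ * monomial G κ w))
      ≈⟨ +-cong (+-identityʳ _) (Σ-zero (upTo (length w)) (λ k _ →
           Σ-zero (words (suc k)) (λ κ κ∈ → nonconstant κ (words-length (suc k) κ∈)))) ⟩
    1# * one w + 0# ≈⟨ trans (+-identityʳ _) (*-identityˡ _) ⟩
    one w ∎
    where
      nonconstant : ∀ κ {k} → length κ ≡ suc k → one κ * monomial G κ w ≈ 0#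
      nonconstant (_ ∷ _) _ = zeroˡ _

  ⊚-order : ∀ {k S} → NoConstantTerm G → OrderAtLeast k S → OrderAtLeast k (S ⊚ G)
  ⊚-order {G} {k} {S} G₀ S-order w |w|<k =
    Σ-zero (upTo (suc (length w))) (λ d _ → Σ-zero (words d) (λ κ _ → term κ))
    where
      term : ∀ κ → S κ * monomial G κ w ≈ 0#
      term κ with length κ <? k
      ... | yes |κ|<k = *-zeroˡ′ _ (S-order κ |κ|<k)
      ... | no  |κ|≮k = *-zeroʳ′ _ (monomial-order G₀ κ w (<-≤-trans |w|<k (≮⇒≥ |κ|≮k)))

  ⊚-local : ∀ {n} S → AgreeBelow n G G′ → ∀ {w} → length w < n → (S ⊚ G) w ≈ (S ⊚ G′) w
  ⊚-local S G≈G′ {w} |w|<n =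
    Σ-cong (upTo (suc (length w))) (λ k → Σ-cong (words k) (λ κ → *-cong refl (monomial-local G≈G′ κ |w|<n)))

  ⊚-local-strict : ∀ {S} → OrderAtLeast 2 S → NoConstantTerm G → NoConstantTerm G′ →
    ∀ {w} → AgreeBelow (length w) G G′ → (S ⊚ G) w ≈ (S ⊚ G′) w
  ⊚-local-strict {G} {G′} {S} S-order G₀ G′₀ {w} G≈G′ = Σ-cong (upTo (suc (length w))) (λ k → Σ-cong (words k) term)
    where
      vanishing : ∀ κ → length κ < 2 → S κ * monomial G κ w ≈ S κ * monomial G′ κ w
      vanishing κ |κ|<2 = trans (*-zeroˡ′ _ (S-order κ |κ|<2)) (sym (*-zeroˡ′ _ (S-order κ |κ|<2)))

      term : ∀ κ → S κ * monomial G κ w ≈ S κ * monomial G′ κ w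
      term []          = vanishing [] (s≤s z≤n)
      term (a ∷ [])    = vanishing (a ∷ []) (s≤s (s≤s z≤n))
      term (a ∷ b ∷ μ) = *-cong refl (monomial-local-strict G₀ G′₀ {w} G≈G′ a b μ)

  ⊚-· : ∀ {F} → NoConstantTerm F → ∀ A B → (A · B) ⊚ F ≋ (A ⊚ F) · (B ⊚ F)
  ⊚-· {F} F₀ A B w = length-induction P step w A B
    where
      P : Word → Set (c ⊔ ℓ)
      P w = ∀ A B → ((A · B) ⊚ F) w ≈ ((A ⊚ F) · (B ⊚ F)) w

      rearrange : ∀ a b e (X Y : Fin N → Carrier) →
        (a * b) * e + Σ[N] (λ j → a * X j + Y j) ≈ a * (b * e + Σ[N] X) + Σ[N] Y
      rearrange a b e X Y = begin
        (a * b) * e + Σ[N] (λ j → a * X j + Y j)          ≈⟨ +-cong refl (Σ-+ (allFin N) _ _) ⟩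
        (a * b) * e + (Σ[N] (λ j → a * X j) + Σ[N] Y)      ≈⟨ +-assoc _ _ _ ⟨
        ((a * b) * e + Σ[N] (λ j → a * X j)) + Σ[N] Y      ≈⟨ +-cong (+-cong (*-assoc _ _ _) (sym (*-distribˡ-Σ (allFin N) a X))) refl ⟩
        (a * (b * e) + a * Σ[N] X) + Σ[N] Y                ≈⟨ +-cong (distribˡ _ _ _) refl ⟨
        a * (b * e + Σ[N] X) + Σ[N] Y                      ∎

      step : ∀ w → (∀ {v} → length v < length w → P v) → P w
      step w IH A B = begin
        ((A · B) ⊚ F) w
          ≈⟨ ⊚-horner F₀ (A · B) w ⟩
        (A · B) [] * one w + Σ[N] (λ j → (F j · (∂ j (A · B) ⊚ F)) w)
          ≈⟨ +-cong (*-cong (+-identityʳ _) refl) (Σ-cong (allFin N) (λ j → ·-local (F j) w (F₀ j) (λ {v} → leibniz j {v}))) ⟩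
        (A [] * B []) * one w + Σ[N] (λ j → (F j · (λ v → A [] * (∂ j B ⊚ F) v + ((∂ j A ⊚ F) · (B ⊚ F)) v)) w)
          ≈⟨ +-cong refl (Σ-cong (allFin N) (λ j → trans (·-+ʳ (F j) _ _ w)
               (+-cong (·-*ʳ (F j) (A []) _ w) (sym (·-assoc (F j) _ _ w))))) ⟩
        (A [] * B []) * one w + Σ[N] (λ j → A [] * (F j · (∂ j B ⊚ F)) w + ((F j · (∂ j A ⊚ F)) · (B ⊚ F)) w)
          ≈⟨ rearrange (A []) (B []) (one w) _ _ ⟩
        A [] * (B [] * one w + Σ[N] (λ j → (F j · (∂ j B ⊚ F)) w)) + Σ[N] (λ j → ((F j · (∂ j A ⊚ F)) · (B ⊚ F)) w)
          ≈⟨ +-cong (*-cong refl (trans (sym (⊚-horner F₀ B w)) (sym (one-· (B ⊚ F) w)))) refl ⟩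
        A [] * (one · (B ⊚ F)) w + Σ[N] (λ j → ((F j · (∂ j A ⊚ F)) · (B ⊚ F)) w)
          ≈⟨ +-cong (·-*ˡ (A []) one (B ⊚ F) w) (·-Σˡ (allFin N) _ (B ⊚ F) w) ⟨
        ((λ u → A [] * one u) · (B ⊚ F)) w + ((λ u → Σ[N] (λ j → (F j · (∂ j A ⊚ F)) u)) · (B ⊚ F)) w
          ≈⟨ ·-+ˡ _ _ (B ⊚ F) w ⟨
        ((λ u → A [] * one u + Σ[N] (λ j → (F j · (∂ j A ⊚ F)) u)) · (B ⊚ F)) w
          ≈⟨ ·-cong (λ u → sym (⊚-horner F₀ A u)) (λ _ → refl) w ⟩
        ((A ⊚ F) · (B ⊚ F)) w ∎
        where
          leibniz : ∀ j {v} → length v < length w →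
            (∂ j (A · B) ⊚ F) v ≈ A [] * (∂ j B ⊚ F) v + ((∂ j A ⊚ F) · (B ⊚ F)) v
          leibniz j {v} |v|<|w| = trans (⊚-cong F (∂-· j A B) v)
            (trans (⊚-+ _ _ F v) (+-cong (⊚-* (A []) (∂ j B) F v) (IH {v} |v|<|w| (∂ j A) B)))

  ⊚-assoc : ∀ {G F} → NoConstantTerm G → NoConstantTerm F → ∀ S → (S ⊚ G) ⊚ F ≋ S ⊚ (G ∘S F)
  ⊚-assoc {G} {F} G₀ F₀ S w = length-induction P step w S
    where
      P : Word → Set (c ⊔ ℓ)
      P w = ∀ S → ((S ⊚ G) ⊚ F) w ≈ (S ⊚ (G ∘S F)) w

      GF₀ : NoConstantTerm (G ∘S F)
      GF₀ j = trans (⊚-constant (G j) F) (G₀ j)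

      step : ∀ w → (∀ {v} → length v < length w → P v) → P w
      step w IH S = begin
        ((S ⊚ G) ⊚ F) w
          ≈⟨ ⊚-cong F (⊚-horner G₀ S) w ⟩
        ((λ v → S [] * one v + Σ[N] (λ j → (G j · (∂ j S ⊚ G)) v)) ⊚ F) w
          ≈⟨ trans (⊚-+ _ _ F w) (+-cong (⊚-* (S []) one F w) (⊚-Σ (allFin N) _ F w)) ⟩
        S [] * (one ⊚ F) w + Σ[N] (λ j → ((G j · (∂ j S ⊚ G)) ⊚ F) w)
          ≈⟨ +-cong (*-cong refl (⊚-one F w)) (Σ-cong (allFin N) (λ j → ⊚-· F₀ (G j) (∂ j S ⊚ G) w)) ⟩
        S [] * one w + Σ[N] (λ j → ((G j ⊚ F) · ((∂ j S ⊚ G) ⊚ F)) w)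
          ≈⟨ +-cong refl (Σ-cong (allFin N) (λ j → ·-local (G j ⊚ F) w (GF₀ j) (λ {v} |v|<|w| → IH {v} |v|<|w| (∂ j S)))) ⟩
        S [] * one w + Σ[N] (λ j → ((G ∘S F) j · (∂ j S ⊚ (G ∘S F))) w)
          ≈⟨ ⊚-horner GF₀ S w ⟨
        (S ⊚ (G ∘S F)) w ∎

  Id-⊚ : ∀ {G} → NoConstantTerm G → ∀ l → Id l ⊚ G ≋ G l
  Id-⊚ {G} G₀ l w = begin
    (Id l ⊚ G) w
      ≈⟨ ⊚-horner G₀ (Id l) w ⟩
    0# * one w + Σ[N] (λ j → (G j · (∂ j (Id l) ⊚ G)) w)
      ≈⟨ +-cong (zeroˡ _) (Σ-cong (allFin N) (λ j → ·-cong (λ _ → refl) (∂Id-⊚ j) w)) ⟩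
    0# + Σ[N] (λ j → (G j · (λ v → δ l j * one v)) w)
      ≈⟨ trans (+-identityˡ _) (Σ-cong (allFin N) (λ j → trans (·-*ʳ (G j) (δ l j) one w) (*-cong refl (·-one (G j) w)))) ⟩
    Σ[N] (λ j → δ l j * G j w)
      ≈⟨ Σ-δˡ l (λ j → G j w) ⟩
    G l w ∎
    where
      ∂Id : ∀ j κ → ∂ j (Id l) κ ≈ δ l j * one κ
      ∂Id j []      = sym (*-identityʳ _)
      ∂Id j (_ ∷ _) = sym (zeroʳ _)

      ∂Id-⊚ : ∀ j → ∂ j (Id l) ⊚ G ≋ (λ v → δ l j * one v)
      ∂Id-⊚ j v = trans (⊚-cong G (∂Id j) v) (trans (⊚-* (δ l j) one G v) (*-cong refl (⊚-one G v)))

  Id-· : ∀ j x X w → (Id j · X) (x ∷ w) ≈ δ j x * X w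
  Id-· j x X w = trans (+-cong (zeroˡ _) (Σ-map _ (splits w) _)) (trans (+-identityˡ _) (first-split-only w))
    where
      first-split-only : ∀ w → Σ-list (splits w) (λ p → Id j (x ∷ proj₁ p) * X (proj₂ p)) ≈ δ j x * X w
      first-split-only []      = +-identityʳ _
      first-split-only (y ∷ w) =
        trans (+-cong refl (trans (Σ-map _ (splits w) _) (Σ-zero (splits w) (λ _ _ → zeroˡ _)))) (+-identityʳ _)

  ⊚-Id : ∀ S → S ⊚ Id ≋ S
  ⊚-Id S []      = ⊚-constant S Id
  ⊚-Id S (x ∷ w) = begin
    (S ⊚ Id) (x ∷ w)
      ≈⟨ ⊚-horner (λ _ → refl) S (x ∷ w) ⟩
    S [] * 0# + Σ[N] (λ j → (Id j · (∂ j S ⊚ Id)) (x ∷ w))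
      ≈⟨ +-cong (zeroʳ _) (Σ-cong (allFin N) (λ j → Id-· j x (∂ j S ⊚ Id) w)) ⟩
    0# + Σ[N] (λ j → δ j x * (∂ j S ⊚ Id) w)
      ≈⟨ trans (+-identityˡ _) (Σ-δʳ x _) ⟩
    (∂ x S ⊚ Id) w
      ≈⟨ ⊚-Id (∂ x S) w ⟩
    S (x ∷ w) ∎

module TreeEnumeration {c ℓ} (R : CommutativeRing c ℓ) (N : ℕ) where
  open Series R N
  open WordProperties R N

  leaf : Fin N → Word → List OddV
  leaf l []          = []
  leaf l (j ∷ [])    with l ≟ j
  ... | yes _ = leafV l ∷ []
  ... | no  _ = []
  leaf l (_ ∷ _ ∷ _) = []

  node : Fin N → List EvenV → List OddV
  node l []           = []
  node l (_ ∷ [])     = []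
  node l (c ∷ d ∷ cs) = nodeV l c d cs ∷ []

  children : OddV → List EvenV
  children (leafV _)         = []
  children (nodeV _ c d cs)  = c ∷ d ∷ cs

  -- The fuel n bounds the nesting depth of internal vertices; as each internal vertex splits
  -- its leaf word into at least two nonempty parts, fuel length w ∸ 1 suffices. Internal
  -- vertices are grouped by the types μ of their children, as in H_l(G) = Σ_μ H_{l,μ} G_μ.
  mutual
    evenTrees : ℕ → Fin N → Word → List EvenV
    evenTrees n i w = concatMap (λ l → map (evenV i) (oddTrees n l w)) (allFin N)

    oddTrees : ℕ → Fin N → Word → List OddV
    oddTrees n l w = leaf l w ++ internalTrees n l w

    internalTrees : ℕ → Fin N → Word → List OddV
    internalTrees zero    l w = []
    internalTrees (suc n) l w =
      concatMap (λ k → concatMap (λ μ → concatMap (node l) (forests n μ w)) (words k)) (upTo (suc (length w)))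

    forests : ℕ → Word → Word → List (List EvenV)
    forests n []      []      = [] ∷ []
    forests n []      (_ ∷ _) = []
    forests n (j ∷ μ) w       =
      concatMap (λ p → cartesianProductWith _∷_ (evenTrees n j (proj₁ p)) (forests n μ (proj₂ p))) (splits w)

  leaf-sound : ∀ l w {o} → o ∈ leaf l w → o ≡ leafV l × w ≡ l ∷ []
  leaf-sound l (j ∷ []) o∈ with l ≟ j
  leaf-sound l (j ∷ []) (here ≡.refl) | yes ≡.refl = ≡.refl , ≡.refl

  node-sound : ∀ l L {o} → o ∈ node l L → typeO o ≡ l × children o ≡ L × leavesO o ≡ leavesL L
  node-sound l (c ∷ d ∷ cs) (here ≡.refl) = ≡.refl , ≡.refl , ≡.refl

  ∈-internalTrees⁻ : ∀ n l w {o} → o ∈ internalTrees (suc n) l w →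
    ∃[ μ ] ∃[ L ] (L ∈ forests n μ w × o ∈ node l L)
  ∈-internalTrees⁻ n l w o∈ with ∈-concatMap-elim _ (upTo (suc (length w))) o∈
  ... | k , _ , o∈ₖ with ∈-concatMap-elim _ (words k) o∈ₖ
  ... | μ , _ , o∈μ with ∈-concatMap-elim (node l) (forests n μ w) o∈μ
  ... | L , L∈ , o∈L = μ , L , L∈ , o∈L

  mutual
    evenTrees-sound : ∀ n i w {T} → T ∈ evenTrees n i w → typeE T ≡ i × leavesE T ≡ w
    evenTrees-sound n i w T∈ with ∈-concatMap-elim _ (allFin N) T∈
    ... | l , _ , T∈ₗ with ∈-map⁻ (evenV i) T∈ₗ
    ... | o , o∈ , ≡.refl = ≡.refl , proj₂ (oddTrees-sound n l w o∈)

    oddTrees-sound : ∀ n l w {o} → o ∈ oddTrees n l w → typeO o ≡ l × leavesO o ≡ w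
    oddTrees-sound n l w o∈ with ∈-++⁻ (leaf l w) o∈
    ... | inj₂ o∈internal = internalTrees-sound n l w o∈internal
    ... | inj₁ o∈leaf with leaf-sound l w o∈leaf
    ...   | ≡.refl , ≡.refl = ≡.refl , ≡.refl

    internalTrees-sound : ∀ n l w {o} → o ∈ internalTrees n l w → typeO o ≡ l × leavesO o ≡ w
    internalTrees-sound (suc n) l w o∈ =
      let μ , L , L∈ , o∈L = ∈-internalTrees⁻ n l w o∈
          type≡ , _ , leaves≡ = node-sound l L o∈L
      in type≡ , ≡.trans leaves≡ (proj₂ (forests-sound n μ w L∈))

    forests-sound : ∀ n μ w {L} → L ∈ forests n μ w → typesL L ≡ μ × leavesL L ≡ w
    forests-sound n []      []  (here ≡.refl) = ≡.refl , ≡.refl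
    forests-sound n (j ∷ μ) w L∈ with ∈-concatMap-elim _ (splits w) L∈
    ... | p , p∈ , L∈ₚ with ∈-cartesianProductWith⁻ _∷_ (evenTrees n j (proj₁ p)) (forests n μ (proj₂ p)) L∈ₚ
    ... | e , es , e∈ , es∈ , ≡.refl with evenTrees-sound n j (proj₁ p) e∈ | forests-sound n μ (proj₂ p) es∈
    ...   | type≡ , leaves≡ | types≡ , leavesL≡ =
      ≡.cong₂ _∷_ type≡ types≡ , ≡.trans (≡.cong₂ _++_ leaves≡ leavesL≡) (splits-sound w p∈)

  leaf-unique : ∀ l w → Unique (leaf l w)
  leaf-unique l []          = []
  leaf-unique l (j ∷ [])    with l ≟ j
  ... | yes _ = All.[] ∷ []
  ... | no  _ = []
  leaf-unique l (_ ∷ _ ∷ _) = []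

  node-unique : ∀ l L → Unique (node l L)
  node-unique l []          = []
  node-unique l (_ ∷ [])    = []
  node-unique l (_ ∷ _ ∷ _) = All.[] ∷ []

  node-internal : ∀ l L {o} → o ∈ node l L → children o ≢ []
  node-internal l (c ∷ d ∷ cs) (here ≡.refl) ()

  childOf : EvenV → OddV
  childOf (evenV _ o) = o

  splitOf : List EvenV → Word × Word
  splitOf []       = [] , []
  splitOf (e ∷ es) = leavesE e , leavesL es

  evenV-injective : ∀ {i o o′} → evenV i o ≡ evenV i o′ → o ≡ o′
  evenV-injective ≡.refl = ≡.refl

  splitOf-sound : ∀ n j μ u v {L} → L ∈ cartesianProductWith _∷_ (evenTrees n j u) (forests n μ v) → splitOf L ≡ (u , v)
  splitOf-sound n j μ u v L∈ with ∈-cartesianProductWith⁻ _∷_ (evenTrees n j u) (forests n μ v) L∈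
  ... | e , es , e∈ , es∈ , ≡.refl = ≡.cong₂ _,_ (proj₂ (evenTrees-sound n j u e∈)) (proj₂ (forests-sound n μ v es∈))

  mutual
    evenTrees-unique : ∀ n i w → Unique (evenTrees n i w)
    evenTrees-unique n i w =
      concatMap⁺-tagged _ (typeO ∘ childOf) (allFin⁺ N) (λ {l} _ → map⁺ evenV-injective (oddTrees-unique n l w)) root-child-type
      where
        root-child-type : ∀ {l T} → l ∈ allFin N → T ∈ map (evenV i) (oddTrees n l w) → typeO (childOf T) ≡ l
        root-child-type {l} _ T∈ = let o , o∈ , T≡ = ∈-map⁻ (evenV i) T∈
                                   in ≡.trans (≡.cong (typeO ∘ childOf) T≡) (proj₁ (oddTrees-sound n l w o∈))

    oddTrees-unique : ∀ n l w → Unique (oddTrees n l w)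
    oddTrees-unique n l w = ++⁺ (leaf-unique l w) (internalTrees-unique n l w)
      (λ (o∈leaf , o∈internal) → internal-children n l w o∈internal (≡.cong children (proj₁ (leaf-sound l w o∈leaf))))

    internalTrees-unique : ∀ n l w → Unique (internalTrees n l w)
    internalTrees-unique zero    l w = []
    internalTrees-unique (suc n) l w =
      concatMap⁺-tagged _ (length ∘ typesL ∘ children) (upTo⁺ (suc (length w))) (λ {k} _ →
        concatMap⁺-tagged _ (typesL ∘ children) (words-unique k) (λ {μ} _ →
          concatMap⁺-tagged (node l) children (forests-unique n μ w) (λ {L} _ → node-unique l L)
            (λ {L} _ o∈ → proj₁ (proj₂ (node-sound l L o∈))))
          (λ {μ} _ o∈ → children-types μ o∈))
        (λ {k} _ o∈ → let μ , μ∈ , o∈μ = ∈-concatMap-elim _ (words k) o∈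
                      in ≡.trans (≡.cong length (children-types μ o∈μ)) (words-length k μ∈))
      where
        children-types : ∀ μ {o} → o ∈ concatMap (node l) (forests n μ w) → typesL (children o) ≡ μ
        children-types μ o∈ = let L , L∈ , o∈L = ∈-concatMap-elim (node l) (forests n μ w) o∈
                              in ≡.trans (≡.cong typesL (proj₁ (proj₂ (node-sound l L o∈L)))) (proj₁ (forests-sound n μ w L∈))

    forests-unique : ∀ n μ w → Unique (forests n μ w)
    forests-unique n []      []      = All.[] ∷ []
    forests-unique n []      (_ ∷ _) = []
    forests-unique n (j ∷ μ) w       =
      concatMap⁺-tagged _ splitOf (splits-unique w)
        (λ {p} _ → cartesianProductWith⁺ _∷_ ∷-injective (evenTrees-unique n j (proj₁ p)) (forests-unique n μ (proj₂ p)))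
        (λ {p} _ → splitOf-sound n j μ (proj₁ p) (proj₂ p))

    internal-children : ∀ n l w {o} → o ∈ internalTrees n l w → children o ≢ []
    internal-children (suc n) l w o∈ = let _ , L , _ , o∈L = ∈-internalTrees⁻ n l w o∈ in node-internal l L o∈L

  mutual
    leavesE-nonempty : ∀ T → 0 < length (leavesE T)
    leavesE-nonempty (evenV _ o) = leavesO-nonempty o

    leavesO-nonempty : ∀ o → 0 < length (leavesO o)
    leavesO-nonempty (leafV _)        = s≤s z≤n
    leavesO-nonempty (nodeV _ c d cs) = <-≤-trans (leavesE-nonempty c) (≤-split-left (leavesE c) _ ≡.refl)

  member-leaves-≤ : ∀ L {e} → e ∈ L → length (leavesE e) ≤ length (leavesL L)
  member-leaves-≤ (e ∷ L)  (here ≡.refl) = ≤-split-left (leavesE e) (leavesL L) ≡.refl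
  member-leaves-≤ (e′ ∷ L) (there e∈)    = ≤-trans (member-leaves-≤ L e∈) (≤-split-right (leavesE e′) (leavesL L) ≡.refl)

  child-shorter : ∀ c d cs {e} → e ∈ c ∷ d ∷ cs → length (leavesE e) < length (leavesL (c ∷ d ∷ cs))
  child-shorter c d cs (here ≡.refl) =
    <-split-left (leavesE c) (leavesL (d ∷ cs)) (<-≤-trans (leavesE-nonempty d) (≤-split-left (leavesE d) _ ≡.refl)) ≡.refl
  child-shorter c d cs (there e∈)    =
    ≤-<-trans (member-leaves-≤ (d ∷ cs) e∈) (<-split-right (leavesE c) (leavesL (d ∷ cs)) (leavesE-nonempty c) ≡.refl)

  degree-≤-leaves : ∀ L → length (typesL L) ≤ length (leavesL L)
  degree-≤-leaves []      = z≤n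
  degree-≤-leaves (e ∷ L) = <-≤-trans (s≤s (degree-≤-leaves L)) (<-split-right (leavesE e) (leavesL L) (leavesE-nonempty e) ≡.refl)

  leaf-complete : ∀ t → leafV t ∈ leaf t (t ∷ [])
  leaf-complete t with t ≟ t
  ... | yes _   = here ≡.refl
  ... | no  t≢t = contradiction ≡.refl t≢t

  mutual
    evenTrees-complete : ∀ n T → length (leavesE T) ≤ suc n → T ∈ evenTrees n (typeE T) (leavesE T)
    evenTrees-complete n (evenV i o) bound =
      ∈-concatMap-intro _ (∈-allFin (typeO o)) (∈-map⁺ (evenV i) (oddTrees-complete n o bound))

    oddTrees-complete : ∀ n o → length (leavesO o) ≤ suc n → o ∈ oddTrees n (typeO o) (leavesO o)
    oddTrees-complete n (leafV t)        _     = ∈-++⁺ˡ (leaf-complete t)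
    oddTrees-complete n (nodeV t c d cs) bound = ∈-++⁺ʳ (leaf t (leavesL (c ∷ d ∷ cs))) (internalTrees-complete n t c d cs bound)

    internalTrees-complete : ∀ n t c d cs → length (leavesL (c ∷ d ∷ cs)) ≤ suc n →
      nodeV t c d cs ∈ internalTrees n t (leavesL (c ∷ d ∷ cs))
    internalTrees-complete zero    t c d cs bound =
      contradiction (<-≤-trans (<-≤-trans (s≤s (leavesE-nonempty c)) (child-shorter c d cs (here ≡.refl))) bound) (<-irrefl ≡.refl)
    internalTrees-complete (suc n) t c d cs bound =
      ∈-concatMap-intro _ (∈-upTo⁺ (s≤s (degree-≤-leaves L)))
        (∈-concatMap-intro _ (∈-words (typesL L))
          (∈-concatMap-intro (node t) (forests-complete n L (λ e∈ → ≤-pred (<-≤-trans (child-shorter c d cs e∈) bound)))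
            (here ≡.refl)))
      where
        L : List EvenV
        L = c ∷ d ∷ cs

    forests-complete : ∀ n L → (∀ {e} → e ∈ L → length (leavesE e) ≤ suc n) → L ∈ forests n (typesL L) (leavesL L)
    forests-complete n []       _     = here ≡.refl
    forests-complete n (e ∷ es) bound =
      ∈-concatMap-intro _ (∈-splits (leavesE e) (leavesL es))
        (∈-cartesianProductWith⁺ _∷_ (evenTrees-complete n e (bound (here ≡.refl))) (forests-complete n es (bound ∘ there)))

  Enumerates : Fin N → Word → List EvenV → Set
  Enumerates i w L = Unique L × (∀ {T} → T ∈ L ⇔ (typeE T ≡ i × leavesE T ≡ w))

  evenTrees-enumerates : ∀ {n i w} → length w ≤ suc n → Enumerates i w (evenTrees n i w)
  evenTrees-enumerates {n} {i} {w} bound = evenTrees-unique n i w , mk⇔ (evenTrees-sound n i w) complete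
    where
      complete : ∀ {T} → typeE T ≡ i × leavesE T ≡ w → T ∈ evenTrees n i w
      complete {T} (type≡ , leaves≡) = ≡.subst₂ (λ i w → T ∈ evenTrees n i w) type≡ leaves≡
        (evenTrees-complete n T (≡.subst (λ w → length w ≤ suc n) (≡.sym leaves≡) bound))

  enumerations-∼set : ∀ {i w L L′} → Enumerates i w L → Enumerates i w L′ → L ∼[ set ] L′
  enumerations-∼set (_ , L⇔) (_ , L′⇔) = ⇔.trans L⇔ (⇔.sym L′⇔)

module Inversion {c ℓ} (R : CommutativeRing c ℓ) (N : ℕ) where
  open CommutativeRing R
  open Series R N
  open SumProperties R N
  open WordProperties R N
  open DeltaProperties R N
  open SubstitutionProperties R N
  open TreeEnumeration R N
  open import Relation.Binary.Reasoning.Setoid setoid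
  open import Algebra.Properties.Group +-group using (ε⁻¹≈ε)

  module TreeSums (Q : Fin N → Fin N → Carrier) (H : Fin N → Word → Carrier) where
    open Weight Q H

    higher : Tuple
    higher l []          = 0#
    higher l (_ ∷ [])    = 0#
    higher l (a ∷ b ∷ κ) = H l (a ∷ b ∷ κ)

    higher-order : ∀ l → OrderAtLeast 2 (higher l)
    higher-order l []          _ = refl
    higher-order l (_ ∷ [])    _ = refl
    higher-order l (_ ∷ _ ∷ _) (s≤s (s≤s ()))

    treeSum : ℕ → Tuple
    treeSum n i w = Σ-list (evenTrees n i w) weightE

    Σ-leaf : ∀ l w → Σ-list (leaf l w) weightO ≈ Id l w
    Σ-leaf l []          = refl
    Σ-leaf l (j ∷ [])    with l ≟ j
    ... | yes _ = +-identityʳ _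
    ... | no  _ = refl
    Σ-leaf l (_ ∷ _ ∷ _) = refl

    Σ-node : ∀ l L → Σ-list (node l L) weightO ≈ higher l (typesL L) * weightL L
    Σ-node l []           = sym (zeroˡ _)
    Σ-node l (_ ∷ [])     = sym (zeroˡ _)
    Σ-node l (c ∷ d ∷ cs) = +-identityʳ _

    Σ-forests : ∀ n μ w → Σ-list (forests n μ w) weightL ≈ monomial (treeSum n) μ w
    Σ-forests n []      []      = +-identityʳ _
    Σ-forests n []      (_ ∷ _) = refl
    Σ-forests n (j ∷ μ) w       = begin
      Σ-list (forests n (j ∷ μ) w) weightL
        ≈⟨ Σ-concatMap _ (splits w) weightL ⟩
      Σ-list (splits w) (λ p → Σ-list (cartesianProductWith _∷_ (evenTrees n j (proj₁ p)) (forests n μ (proj₂ p))) weightL)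
        ≈⟨ Σ-cong (splits w) (λ p → Σ-cartesianProductWith _∷_ (evenTrees n j (proj₁ p)) (forests n μ (proj₂ p)) weightL) ⟩
      Σ-list (splits w) (λ p → Σ-list (evenTrees n j (proj₁ p)) (λ e →
                                 Σ-list (forests n μ (proj₂ p)) (λ es → weightE e * weightL es)))
        ≈⟨ Σ-cong (splits w) (λ p → Σ-cong (evenTrees n j (proj₁ p)) (λ e → *-distribˡ-Σ (forests n μ (proj₂ p)) _ _)) ⟨
      Σ-list (splits w) (λ p → Σ-list (evenTrees n j (proj₁ p)) (λ e → weightE e * Σ-list (forests n μ (proj₂ p)) weightL))
        ≈⟨ Σ-cong (splits w) (λ p → *-distribʳ-Σ (evenTrees n j (proj₁ p)) _ _) ⟨
      Σ-list (splits w) (λ p → treeSum n j (proj₁ p) * Σ-list (forests n μ (proj₂ p)) weightL)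
        ≈⟨ Σ-cong (splits w) (λ p → *-cong refl (Σ-forests n μ (proj₂ p))) ⟩
      monomial (treeSum n) (j ∷ μ) w ∎

    Σ-internalTrees : ∀ n l w → Σ-list (internalTrees (suc n) l w) weightO ≈ (higher l ⊚ treeSum n) w
    Σ-internalTrees n l w =
      trans (Σ-concatMap (λ k → concatMap nodes-of-type (words k)) (upTo (suc (length w))) weightO)
        (Σ-cong (upTo (suc (length w))) (λ k →
          trans (Σ-concatMap nodes-of-type (words k) weightO) (Σ-cong (words k) Σ-nodes-of-type)))
      where
        nodes-of-type : Word → List OddV
        nodes-of-type μ = concatMap (node l) (forests n μ w)

        Σ-nodes-of-type : ∀ μ → Σ-list (nodes-of-type μ) weightO ≈ higher l μ * monomial (treeSum n) μ w
        Σ-nodes-of-type μ = begin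
          Σ-list (nodes-of-type μ) weightO
            ≈⟨ Σ-concatMap (node l) (forests n μ w) weightO ⟩
          Σ-list (forests n μ w) (λ L → Σ-list (node l L) weightO)
            ≈⟨ Σ-cong-∈ (forests n μ w) (λ L L∈ → trans (Σ-node l L)
                 (*-cong (reflexive (≡.cong (higher l) (proj₁ (forests-sound n μ w L∈)))) refl)) ⟩
          Σ-list (forests n μ w) (λ L → higher l μ * weightL L)
            ≈⟨ *-distribˡ-Σ (forests n μ w) _ _ ⟨
          higher l μ * Σ-list (forests n μ w) weightL
            ≈⟨ *-cong refl (Σ-forests n μ w) ⟩
          higher l μ * monomial (treeSum n) μ w ∎

    treeSum-suc : ∀ n i w → treeSum (suc n) i w ≈ Σ[N] (λ l → Q i l * (Id l w + (higher l ⊚ treeSum n) w))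
    treeSum-suc n i w =
      trans (Σ-concatMap _ (allFin N) weightE) (Σ-cong (allFin N) (λ l → begin
        Σ-list (map (evenV i) (oddTrees (suc n) l w)) weightE
          ≈⟨ Σ-map (evenV i) (oddTrees (suc n) l w) weightE ⟩
        Σ-list (oddTrees (suc n) l w) (λ o → Q i (typeO o) * weightO o)
          ≈⟨ Σ-cong-∈ (oddTrees (suc n) l w) (λ o o∈ →
               *-cong (reflexive (≡.cong (Q i) (proj₁ (oddTrees-sound (suc n) l w o∈)))) refl) ⟩
        Σ-list (oddTrees (suc n) l w) (λ o → Q i l * weightO o)
          ≈⟨ *-distribˡ-Σ (oddTrees (suc n) l w) _ _ ⟨
        Q i l * Σ-list (oddTrees (suc n) l w) weightO
          ≈⟨ *-cong refl (trans (Σ-++ (leaf l w) _ weightO) (+-cong (Σ-leaf l w) (Σ-internalTrees n l w))) ⟩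
        Q i l * (Id l w + (higher l ⊚ treeSum n) w) ∎))

    G : Tuple
    G i w = treeSum (suc (length w)) i w

    G-trees : ∀ {i w L} → Enumerates i w L → G i w ≈ Σ-list L weightE
    G-trees {i} {w} L-enumerates = Σ-∼set weightE (proj₁ all-trees) (proj₁ L-enumerates) (enumerations-∼set all-trees L-enumerates)
      where
        all-trees : Enumerates i w (evenTrees (suc (length w)) i w)
        all-trees = evenTrees-enumerates (≤-trans (n≤1+n _) (n≤1+n _))

    treeSum≈G : ∀ {n i w} → length w ≤ suc n → treeSum n i w ≈ G i w
    treeSum≈G bound = sym (G-trees (evenTrees-enumerates bound))

    G-fixpoint : ∀ i w → G i w ≈ Σ[N] (λ l → Q i l * (Id l w + (higher l ⊚ G) w))
    G-fixpoint i w = trans (treeSum-suc (length w) i w) (Σ-cong (allFin N) (λ l → *-cong refl (+-cong refl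
      (⊚-local (higher l) (λ j u |u|<1+|w| → treeSum≈G (<⇒≤ |u|<1+|w|)) {w} (n<1+n (length w))))))

    G-no-constant : NoConstantTerm G
    G-no-constant i = trans (G-fixpoint i []) (Σ-zero (allFin N) (λ l _ →
      *-zeroʳ′ _ (trans (+-identityˡ _) (⊚-constant (higher l) G))))

    G-linear : ∀ i j → G i (j ∷ []) ≈ Q i j
    G-linear i j = begin
      G i (j ∷ [])
        ≈⟨ G-fixpoint i (j ∷ []) ⟩
      Σ[N] (λ l → Q i l * (δ l j + (higher l ⊚ G) (j ∷ [])))
        ≈⟨ Σ-cong (allFin N) (λ l → *-cong refl (+-cong refl (⊚-order G-no-constant (higher-order l) (j ∷ []) (s≤s (s≤s z≤n))))) ⟩
      Σ[N] (λ l → Q i l * (δ l j + 0#))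
        ≈⟨ Σ-cong (allFin N) (λ l → trans (*-cong refl (+-identityʳ _)) (*-comm _ _)) ⟩
      Σ[N] (λ l → δ l j * Q i l)
        ≈⟨ Σ-δʳ j (Q i) ⟩
      Q i j ∎

  module Inverse (P Q : Fin N → Fin N → Carrier) (H : Fin N → Word → Carrier)
                 (PQ≈δ : ∀ i j → (P ⊗ Q) i j ≈ δ i j) (QP≈δ : ∀ i j → (Q ⊗ P) i j ≈ δ i j) where
    open TreeSums Q H

    F : Tuple
    F = mkF P H

    F-no-constant : NoConstantTerm F
    F-no-constant _ = refl

    F-decomposition : ∀ i κ → F i κ ≈ Σ[N] (λ j → P i j * Id j κ) + - higher i κ
    F-decomposition i []          = sym (trans (+-cong (Σ-zero (allFin N) (λ _ _ → zeroʳ _)) ε⁻¹≈ε) (+-identityʳ _))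
    F-decomposition i (k ∷ [])    = sym (trans (+-cong (trans (Σ-cong (allFin N) (λ _ → *-comm _ _)) (Σ-δʳ k (P i))) ε⁻¹≈ε)
                                               (+-identityʳ _))
    F-decomposition i (_ ∷ _ ∷ _) = sym (trans (+-cong (Σ-zero (allFin N) (λ _ _ → zeroʳ _)) refl) (+-identityˡ _))

    F∘G≈Id : (F ∘S G) ≈S Id
    F∘G≈Id i w = begin
      (F i ⊚ G) w
        ≈⟨ ⊚-cong G (F-decomposition i) w ⟩
      ((λ κ → Σ[N] (λ j → P i j * Id j κ) + - higher i κ) ⊚ G) w
        ≈⟨ ⊚-+ _ _ G w ⟩
      ((λ κ → Σ[N] (λ j → P i j * Id j κ)) ⊚ G) w + ((λ κ → - higher i κ) ⊚ G) w
        ≈⟨ +-cong (trans (⊚-Σ (allFin N) _ G w) (Σ-cong (allFin N) (λ j → trans (⊚-* (P i j) (Id j) G w)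
                    (*-cong refl (Id-⊚ G-no-constant j w)))))
                  (⊚-neg (higher i) G w) ⟩
      Σ[N] (λ j → P i j * G j w) + - (higher i ⊚ G) w
        ≈⟨ +-cong (Σ-cong (allFin N) (λ j → *-cong refl (G-fixpoint j w))) refl ⟩
      Σ[N] (λ j → P i j * Σ[N] (λ l → Q j l * (Id l w + (higher l ⊚ G) w))) + - (higher i ⊚ G) w
        ≈⟨ +-cong (Σ-inverse PQ≈δ i (λ l → Id l w + (higher l ⊚ G) w)) refl ⟩
      (Id i w + (higher i ⊚ G) w) + - (higher i ⊚ G) w
        ≈⟨ trans (+-assoc _ _ _) (trans (+-cong refl (-‿inverseʳ _)) (+-identityʳ _)) ⟩
      Id i w ∎

    G∘F≈Id : (G ∘S F) ≈S Id
    G∘F≈Id i w = length-induction (λ w → ∀ i → (G ∘S F) i w ≈ Id i w) step w i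
      where
        G∘F-no-constant : NoConstantTerm (G ∘S F)
        G∘F-no-constant j = trans (⊚-constant (G j) F) (G-no-constant j)

        step : ∀ w → (∀ {v} → length v < length w → ∀ i → (G ∘S F) i v ≈ Id i v) → ∀ i → (G ∘S F) i w ≈ Id i w
        step w IH i = begin
          (G i ⊚ F) w
            ≈⟨ ⊚-cong F (G-fixpoint i) w ⟩
          ((λ κ → Σ[N] (λ l → Q i l * (Id l κ + (higher l ⊚ G) κ))) ⊚ F) w
            ≈⟨ trans (⊚-Σ (allFin N) _ F w) (Σ-cong (allFin N) (λ l →
                 trans (⊚-* (Q i l) _ F w) (*-cong refl (⊚-+ (Id l) (higher l ⊚ G) F w)))) ⟩
          Σ[N] (λ l → Q i l * ((Id l ⊚ F) w + ((higher l ⊚ G) ⊚ F) w))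
            ≈⟨ Σ-cong (allFin N) (λ l → *-cong refl (+-cong (trans (Id-⊚ F-no-constant l w) (F-decomposition l w))
                                                             (⊚-assoc G-no-constant F-no-constant (higher l) w))) ⟩
          Σ[N] (λ l → Q i l * ((Σ[N] (λ j → P l j * Id j w) + - higher l w) + (higher l ⊚ (G ∘S F)) w))
            ≈⟨ Σ-cong (allFin N) (λ l → *-cong refl (cancel (higher-⊚-G∘F l))) ⟩
          Σ[N] (λ l → Q i l * Σ[N] (λ j → P l j * Id j w))
            ≈⟨ Σ-inverse QP≈δ i (λ j → Id j w) ⟩
          Id i w ∎
          where
            higher-⊚-G∘F : ∀ l → (higher l ⊚ (G ∘S F)) w ≈ higher l w
            higher-⊚-G∘F l = trans (⊚-local-strict (higher-order l) G∘F-no-constant (λ _ → refl) {w} (λ j u |u|<|w| → IH {u} |u|<|w| j))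
                                    (⊚-Id (higher l) w)

            cancel : ∀ {a b c} → c ≈ b → (a + - b) + c ≈ a
            cancel c≈b = trans (+-assoc _ _ _) (trans (+-cong refl (trans (+-cong refl c≈b) (-‿inverseˡ _))) (+-identityʳ _))

theorem3p4 : ∀ {c ℓ} (R : CommutativeRing c ℓ) (N : ℕ) → 1 ≤ N →
    let open CommutativeRing R
        open Series R N
    in (P Q : Fin N → Fin N → Carrier) (H : Fin N → Word → Carrier) →
       (∀ i j → (P ⊗ Q) i j ≈ δ i j) →
       (∀ i j → (Q ⊗ P) i j ≈ δ i j) →
       Σ[ G ∈ Tuple ]
         ( ((mkF P H ∘S G) ≈S Id)
         × ((G ∘S mkF P H) ≈S Id)
         × (∀ i → G i [] ≈ 0#)
         × (∀ i j → G i (j ∷ []) ≈ Q i j)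
         × (∀ i (κ : Word) → 2 ≤ length κ →
              (L : List EvenV) → Unique L →
              (∀ T → T ∈ L → (typeE T ≡ i × leavesE T ≡ κ)) →
              (∀ T → (typeE T ≡ i × leavesE T ≡ κ) → T ∈ L) →
              G i κ ≈ Σ-list L (Weight.weightE Q H)) )
theorem3p4 R N _ P Q H PQ≈δ QP≈δ =
  G , F∘G≈Id , G∘F≈Id , G-no-constant , G-linear ,
  -- The tree formula holds for every κ.
  λ i κ _ L L-unique L-sound L-complete → G-trees (L-unique , mk⇔ (L-sound _) (L-complete _))
  where
    open Inversion R N
    open TreeSums Q H
    open Inverse P Q H PQ≈δ QP≈δ
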